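{- Let $m,n\ge2$ be integers, $R=[0,m-1]\times[0,n-1]$ and $u\in\ker BW\setminus\{0\}$. Every horizontal or vertical active side of a chunk of $\Phi_b(u)$ has length $2$.
   Context: $G=R\cap\mathbb{Z}^2$ is the $m\times n$ rectangular graph, with $(x,y),(x',y')$ adjacent in $G$ iff $|x-x'|+|y-y'|=1$; a point is black if $x+y$ is even, white otherwise. $BW$ maps a $\mathbb{Z}/(2)$-valued function $u$ on black points of $G$ to the function on white points $w\mapsto\sum_{b\text{ black neighbor of }w}u(b)\pmod 2$. $A_u$ is the set of black points $b$ with $u(b)=1$. Two points $b_1,b_2\in A_u$ are adjacent in $A_u$ if (i) they have a common white neighbor $w$ in $G$, and (ii) either $\overline{wb_1}\perp\overline{wb_2}$, or $b_1,b_2$ are the only points of $A_u$ among the neighbors of $w$; the segments $\overline{b_1b_2}$ for adjacent $b_1,b_2$ are the segments of $A_u$. $\Phi_b(u)$ is $\mathrm{int}(R)$ minus the union of the segments of $A_u$; its chunks are the closures of its connected components, which are convex polygons. A side of a chunk (a maximal straight piece of its boundary) is active if it consists only of segments of $A_u$. -}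

module Defs where

open import Data.Nat using (ℕ; zero; suc; _+_; _<_; _≤_; _<ᵇ_; _%_; _≡ᵇ_)
open import Data.Bool using (Bool; true; false; _∧_; _∨_; _xor_; not; if_then_else_)
open import Data.Product using (Σ; _×_; _,_; ∃)
open import Data.Sum using (_⊎_)
open import Data.Empty using (⊥)
open import Data.Unit using (⊤)
open import Relation.Nullary using (¬_)
open import Relation.Binary.PropositionalEquality using (_≡_)
open import Relation.Binary.Construct.Closure.ReflexiveTransitive using (Star)
open import Relation.Binary.Construct.Closure.Symmetric using (SymClosure)

-- Grid G = {0..m-1} x {0..n-1}.  A Z/(2)-valued function is a Bool-valued
-- function on ℕ × ℕ; only its values at black points of G are ever used.
Fn : Set
Fn = ℕ → ℕ → Bool

isBlack : ℕ → ℕ → Bool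
isBlack x y = ((x + y) % 2) ≡ᵇ 0

-- indicator of A_u (false outside G and at white points)
inA : ℕ → ℕ → Fn → ℕ → ℕ → Bool
inA m n u x y = (x <ᵇ m) ∧ ((y <ᵇ n) ∧ (isBlack x y ∧ u x y))

leftA : ℕ → ℕ → Fn → ℕ → ℕ → Bool
leftA m n u zero    y = false
leftA m n u (suc x) y = inA m n u x y

downA : ℕ → ℕ → Fn → ℕ → ℕ → Bool
downA m n u x zero    = false
downA m n u x (suc y) = inA m n u x y

BW : ℕ → ℕ → Fn → ℕ → ℕ → Bool
BW m n u x y =
  (inA m n u (suc x) y xor inA m n u x (suc y)) xor (leftA m n u x y xor downA m n u x y)

InKerBW : ℕ → ℕ → Fn → Set
InKerBW m n u = ∀ x y → x < m → y < n → isBlack x y ≡ false → BW m n u x y ≡ false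

NonZeroOnBlack : ℕ → ℕ → Fn → Set
NonZeroOnBlack m n u = Σ ℕ λ x → Σ ℕ λ y → inA m n u x y ≡ true

-- Every segment of A_u is either the black diagonal of a unit square
-- (case "perpendicular"), or a horizontal/vertical segment of length 2
-- centred at a white point w (case "b1,b2 the only points of A_u
-- among the neighbours of w").

diagSeg : ℕ → ℕ → Fn → ℕ → ℕ → Bool
diagSeg m n u x y =
  if isBlack x y then inA m n u x y ∧ inA m n u (suc x) (suc y)
                 else inA m n u (suc x) y ∧ inA m n u x (suc y)

hSegAt : ℕ → ℕ → Fn → ℕ → ℕ → Bool
hSegAt m n u zero    y = false
hSegAt m n u (suc x) y =
  not (isBlack (suc x) y) ∧ (inA m n u x y ∧ (inA m n u (suc (suc x)) y ∧
    (not (inA m n u (suc x) (suc y)) ∧ not (downA m n u (suc x) y))))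

vSegAt : ℕ → ℕ → Fn → ℕ → ℕ → Bool
vSegAt m n u x zero    = false
vSegAt m n u x (suc y) =
  not (isBlack x (suc y)) ∧ (inA m n u x y ∧ (inA m n u x (suc (suc y)) ∧
    (not (inA m n u (suc x) (suc y)) ∧ not (leftA m n u x (suc y)))))

hCov : ℕ → ℕ → Fn → ℕ → ℕ → Bool
hCov m n u x y = hSegAt m n u x y ∨ hSegAt m n u (suc x) y

vCov : ℕ → ℕ → Fn → ℕ → ℕ → Bool
vCov m n u x y = vSegAt m n u x y ∨ vSegAt m n u x (suc y)

-- Each unit square [x,x+1]×[y,y+1] of R is cut by its black
-- diagonal into a lower triangle (false; contains the bottom edge) and an
-- upper triangle (true; contains the top edge).  All segments of A_u are
-- unions of edges of these triangles, so the components of Φ_b(u) are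
-- unions of (open) triangles glued along open edges not on any segment.

Tri : Set
Tri = ℕ × ℕ × Bool

SqIn : ℕ → ℕ → ℕ → ℕ → Set
SqIn m n x y = suc x < m × suc y < n

-- the triangle of square (x,y) containing its right edge / left edge
rightTri : ℕ → ℕ → Bool
rightTri x y = not (isBlack x y)

leftTri : ℕ → ℕ → Bool
leftTri x y = isBlack x y

data Adj (m n : ℕ) (u : Fn) : Tri → Tri → Set where
  inSq    : ∀ {x y} → SqIn m n x y → diagSeg m n u x y ≡ false →
            Adj m n u (x , y , false) (x , y , true)
  acrossH : ∀ {x y} → SqIn m n x y → SqIn m n x (suc y) → hCov m n u x (suc y) ≡ false →
            Adj m n u (x , y , true) (x , suc y , false)
  acrossV : ∀ {x y} → SqIn m n x y → SqIn m n (suc x) y → vCov m n u (suc x) y ≡ false →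
            Adj m n u (x , y , rightTri x y) (suc x , y , leftTri (suc x) y)

Conn : ℕ → ℕ → Fn → Tri → Tri → Set
Conn m n u = Star (SymClosure (Adj m n u))

Mem : ℕ → ℕ → Fn → Tri → ℕ → ℕ → Bool → Set
Mem m n u t0 x y k = SqIn m n x y × Conn m n u t0 (x , y , k)

HBelow : ℕ → ℕ → Fn → Tri → ℕ → ℕ → Set
HBelow m n u t0 x zero    = ⊥
HBelow m n u t0 x (suc y) = Mem m n u t0 x y true

HAbove : ℕ → ℕ → Fn → Tri → ℕ → ℕ → Set
HAbove m n u t0 x y = Mem m n u t0 x y false

HBdry : ℕ → ℕ → Fn → Tri → ℕ → ℕ → Set
HBdry m n u t0 x y =
  (HBelow m n u t0 x y × ¬ HAbove m n u t0 x y) ⊎ (HAbove m n u t0 x y × ¬ HBelow m n u t0 x y)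

VLeft : ℕ → ℕ → Fn → Tri → ℕ → ℕ → Set
VLeft m n u t0 zero    y = ⊥
VLeft m n u t0 (suc x) y = Mem m n u t0 x y (rightTri x y)

VRight : ℕ → ℕ → Fn → Tri → ℕ → ℕ → Set
VRight m n u t0 x y = Mem m n u t0 x y (leftTri x y)

VBdry : ℕ → ℕ → Fn → Tri → ℕ → ℕ → Set
VBdry m n u t0 x y =
  (VLeft m n u t0 x y × ¬ VRight m n u t0 x y) ⊎ (VRight m n u t0 x y × ¬ VLeft m n u t0 x y)

HStartMax : ℕ → ℕ → Fn → Tri → ℕ → ℕ → Set
HStartMax m n u t0 zero    y = ⊤
HStartMax m n u t0 (suc a) y = ¬ HBdry m n u t0 a y

VStartMax : ℕ → ℕ → Fn → Tri → ℕ → ℕ → Set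
VStartMax m n u t0 x zero    = ⊤
VStartMax m n u t0 x (suc b) = ¬ VBdry m n u t0 x b

-- [a,a+k]×{y} is a horizontal side (maximal straight piece of the boundary)
-- of the chunk of t0, and it is active (consists only of segments of A_u)
HActiveSide : ℕ → ℕ → Fn → Tri → ℕ → ℕ → ℕ → Set
HActiveSide m n u t0 a y k =
  1 ≤ k × ((∀ i → i < k → HBdry m n u t0 (a + i) y) ×
  (HStartMax m n u t0 a y × (¬ HBdry m n u t0 (a + k) y ×
  (∀ i → i < k → hCov m n u (a + i) y ≡ true))))

VActiveSide : ℕ → ℕ → Fn → Tri → ℕ → ℕ → ℕ → Set
VActiveSide m n u t0 x b k =
  1 ≤ k × ((∀ i → i < k → VBdry m n u t0 x (b + i)) ×
  (VStartMax m n u t0 x b × (¬ VBdry m n u t0 x (b + k) ×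
  (∀ i → i < k → vCov m n u x (b + i) ≡ true))))

{-# OPTIONS --safe #-}
module Submission where

open import Defs
open import Data.Nat using (ℕ; _≤_)
open import Data.Bool using (Bool)
open import Data.Product using (_×_; _,_)
open import Relation.Binary.PropositionalEquality using (_≡_)

open import Data.Bool using (true; false; not; _∧_; _∨_; _xor_)
open import Data.Bool.Properties
  using (not-injective; ∨-conicalˡ; ∨-conicalʳ; ∧-conicalˡ; ∧-conicalʳ; ∧-comm; T-≡)
open import Data.Empty using (⊥; ⊥-elim)
open import Data.Nat using (zero; suc; _+_; _<_; _<ᵇ_; _%_; _≡ᵇ_; s≤s; z<s; s<s)
open import Data.Nat.Properties
open import Data.Product using (∃; proj₁; proj₂)
open import Data.Product.Function.NonDependent.Propositional using (_×-⇔_)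
open import Data.Sum using (_⊎_; inj₁; inj₂)
open import Data.Sum.Function.Propositional using (_⊎-⇔_)
open import Function using (_∘_; _⇔_; mk⇔; Equivalence)
open import Function.Related.TypeIsomorphisms using (¬-cong-⇔)
open import Relation.Binary.Construct.Closure.ReflexiveTransitive as Star using (ε; _◅_; _◅◅_)
open import Relation.Binary.Construct.Closure.Symmetric as Sym using (fwd; bwd)
open import Relation.Binary.Definitions using (tri<; tri≈; tri>)
open import Relation.Binary.PropositionalEquality
  using (_≢_; refl; sym; trans; cong; cong₂; subst; module ≡-Reasoning)
open import Relation.Nullary using (¬_)

-- At a white point w the kernel condition says that A_u contains an even number of the four
-- black neighbours of w: A_u has the same parity on {west, north} as on {south, east}, and the
-- same parity on {west, south} as on {north, east}.  One step along the anti-diagonal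
-- (resp. diagonal) through w turns the south-east (resp. north-east) pair of w into the
-- north-west (resp. south-west) pair of the next white point, so if that pair is odd at w it is
-- odd at every point of the line in R.  The points of A_u next to such a line then form a wall:
-- place every triangle on the side of the line where its right-angled white vertex lies, and
-- triangles whose vertex is on the line according to the segments through that vertex; no
-- adjacency of triangles across an edge that is not on a segment changes the side, so a chunk
-- lies on one side of the wall.
--
-- Let w be the centre of a horizontal segment of A_u.  No segment crosses the vertical line
-- through w near w, so the two halves of the segment are boundary edges of a chunk together.
-- Both walls through w exist, and a boundary edge continuing a side beyond an end of the segment
-- would put the chunk on both sides of one of them.  So an active side is a single segment, of
-- length 2.  Vertical sides are symmetric.

isEven : ℕ → Bool
isEven s = s % 2 ≡ᵇ 0

isEven-suc : ∀ s → isEven (suc s) ≡ not (isEven s)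
isEven-suc zero          = refl
isEven-suc (suc zero)    = refl
isEven-suc (suc (suc s)) = isEven-suc s

isBlack-sucˡ : ∀ x y → isBlack (suc x) y ≡ not (isBlack x y)
isBlack-sucˡ x y = isEven-suc (x + y)

isBlack-sucʳ : ∀ x y → isBlack x (suc y) ≡ not (isBlack x y)
isBlack-sucʳ x y = trans (cong isEven (+-suc x y)) (isEven-suc (x + y))

isBlack-suc-suc : ∀ x y → isBlack (suc x) (suc y) ≡ isBlack x y
isBlack-suc-suc x y = cong (isEven ∘ suc) (+-suc x y)

isBlack-diagonal : ∀ i j x y → i + y ≡ j + x → isBlack i j ≡ isBlack x y
isBlack-diagonal zero    j       zero    y       e = cong isEven (trans (sym (+-identityʳ j)) (sym e))
isBlack-diagonal zero    j       (suc x) zero    e = ⊥-elim (0≢1+n (trans e (+-suc j x)))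
isBlack-diagonal zero    j       (suc x) (suc y) e =
  trans (isBlack-diagonal 0 j x y (suc-injective (trans e (+-suc j x)))) (sym (isBlack-suc-suc x y))
isBlack-diagonal (suc i) zero    zero    y       ()
isBlack-diagonal (suc i) (suc j) zero    y       e =
  trans (isBlack-suc-suc i j) (isBlack-diagonal i j 0 y (suc-injective e))
isBlack-diagonal (suc i) j       (suc x) y       e = begin
  isBlack (suc i) j       ≡⟨ isBlack-sucˡ i j ⟩
  not (isBlack i j)       ≡⟨ cong not (isBlack-diagonal i j x y (suc-injective (trans e (+-suc j x)))) ⟩
  not (isBlack x y)       ≡⟨ isBlack-sucˡ x y ⟨
  isBlack (suc x) y       ∎
  where open ≡-Reasoning

xor-balance : ∀ a b c d → (a xor b) xor (c xor d) ≡ false → (c xor b ≡ d xor a) × (c xor d ≡ b xor a)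
xor-balance false false false false _ = refl , refl
xor-balance false false false true  ()
xor-balance false false true  false ()
xor-balance false false true  true  _ = refl , refl
xor-balance false true  false false ()
xor-balance false true  false true  _ = refl , refl
xor-balance false true  true  false _ = refl , refl
xor-balance false true  true  true  ()
xor-balance true  false false false ()
xor-balance true  false false true  _ = refl , refl
xor-balance true  false true  false _ = refl , refl
xor-balance true  false true  true  ()
xor-balance true  true  false false _ = refl , refl
xor-balance true  true  false true  ()
xor-balance true  true  true  false ()
xor-balance true  true  true  true  _ = refl , refl

xor-true-partners : ∀ a a′ b b′ → a xor a′ ≡ true → b xor b′ ≡ true → a ∧ b ≡ false →
                    not a′ ∧ not b′ ≡ false
xor-true-partners true  false false true  _ _ _ = refl
xor-true-partners false true  b     b′    _ _ _ = refl
xor-true-partners true  false true  false _ _ ()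
xor-true-partners true  true  _     _     ()
xor-true-partners false false _     _     ()
xor-true-partners true  false false false _ () _
xor-true-partners true  false true  true  _ () _

∧-true⁵ : ∀ a b c d e → a ∧ (b ∧ (c ∧ (d ∧ e))) ≡ true →
          a ≡ true × b ≡ true × c ≡ true × d ≡ true × e ≡ true
∧-true⁵ true  true  true  true  true  _ = refl , refl , refl , refl , refl
∧-true⁵ true  true  true  true  false ()
∧-true⁵ true  true  true  false _     ()
∧-true⁵ true  true  false _     _     ()
∧-true⁵ true  false _     _     _     ()
∧-true⁵ false _     _     _     _     ()

∨-true : ∀ {a b} → a ∨ b ≡ true → a ≡ true ⊎ b ≡ true
∨-true {true}  _ = inj₁ refl
∨-true {false} b = inj₂ b

sideOf : ℕ → ℕ → Bool → Bool
sideOf a b tie with <-cmp a b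
... | tri< _ _ _ = false
... | tri≈ _ _ _ = tie
... | tri> _ _ _ = true

sideOf-< : ∀ {a b} tie → a < b → sideOf a b tie ≡ false
sideOf-< {a} {b} _ a<b with <-cmp a b
... | tri< _ _ _   = refl
... | tri≈ a≮b _ _ = ⊥-elim (a≮b a<b)
... | tri> a≮b _ _ = ⊥-elim (a≮b a<b)

sideOf-> : ∀ {a b} tie → b < a → sideOf a b tie ≡ true
sideOf-> {a} {b} _ b<a with <-cmp a b
... | tri< _ _ b≮a = ⊥-elim (b≮a b<a)
... | tri≈ _ _ b≮a = ⊥-elim (b≮a b<a)
... | tri> _ _ _   = refl

sideOf-≡ : ∀ {a b} tie → a ≡ b → sideOf a b tie ≡ tie
sideOf-≡ {a} {b} _ a≡b with <-cmp a b
... | tri< _ a≢b _ = ⊥-elim (a≢b a≡b)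
... | tri≈ _ _ _   = refl
... | tri> _ a≢b _ = ⊥-elim (a≢b a≡b)

sideOf-cong : ∀ a b {t t′} → (a ≡ b → t ≡ t′) → sideOf a b t ≡ sideOf a b t′
sideOf-cong a b t≡t′ with <-cmp a b
... | tri< _ _ _   = refl
... | tri≈ _ a≡b _ = t≡t′ a≡b
... | tri> _ _ _   = refl

sideOf-suc : ∀ a b tie → sideOf (suc a) (suc b) tie ≡ sideOf a b tie
sideOf-suc a b tie with <-cmp a b
... | tri< a<b _ _ = sideOf-< tie (s<s a<b)
... | tri≈ _ a≡b _ = sideOf-≡ tie (cong suc a≡b)
... | tri> _ _ b<a = sideOf-> tie (s<s b<a)

sideOf-≤ : ∀ {a b} tie → a ≤ b → (a ≡ b → tie ≡ false) → sideOf a b tie ≡ false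
sideOf-≤ tie a≤b on-line with m≤n⇒m<n∨m≡n a≤b
... | inj₁ a<b = sideOf-< tie a<b
... | inj₂ a≡b = trans (sideOf-≡ tie a≡b) (on-line a≡b)

sideOf-≥ : ∀ {a b} tie → b ≤ a → (a ≡ b → tie ≡ true) → sideOf a b tie ≡ true
sideOf-≥ tie b≤a on-line with m≤n⇒m<n∨m≡n b≤a
... | inj₁ b<a = sideOf-> tie b<a
... | inj₂ b≡a = trans (sideOf-≡ tie (sym b≡a)) (on-line (sym b≡a))

sideOf-+2 : ∀ {d s t t′} → suc d ≢ s → (d ≡ s → t ≡ true) → (suc (suc d) ≡ s → t′ ≡ false) →
            sideOf d s t ≡ sideOf (suc (suc d)) s t′
sideOf-+2 {d} {s} {t} {t′} d+1≢s on-d on-d+2 with <-cmp d s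
... | tri< d<s _ _ = sym (sideOf-≤ t′ (≤∧≢⇒< d<s d+1≢s) on-d+2)
... | tri≈ _ d≡s _ = trans (on-d d≡s) (sym (sideOf-> t′ (s≤s (≤-trans (≤-reflexive (sym d≡s)) (n≤1+n d)))))
... | tri> _ _ s<d = sym (sideOf-> t′ (<-trans s<d (m<n+m d z<s)))

sideOf-shift : ∀ {a b t t′} → a ≢ b → (suc a ≡ b → t ≡ false) → (a ≡ suc b → t′ ≡ true) →
               sideOf (suc a) b t ≡ sideOf a (suc b) t′
sideOf-shift {a} {b} {t} {t′} a≢b on-left on-right with <-cmp a b
... | tri< a<b _ _ = trans (sideOf-≤ t a<b on-left) (sym (sideOf-< t′ (m<n⇒m<1+n a<b)))
... | tri≈ _ a≡b _ = ⊥-elim (a≢b a≡b)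
... | tri> _ _ b<a = trans (sideOf-> t (m<n⇒m<1+n b<a)) (sym (sideOf-≥ t′ b<a on-right))

module Neighbourhood (m n : ℕ) (u : Fn) where

  A : ℕ → ℕ → Bool
  A = inA m n u

  west south north east : ℕ → ℕ → Bool
  west      = leftA m n u
  south     = downA m n u
  north i j = A i (suc j)
  east  i j = A (suc i) j

  nwParity seParity swParity neParity : ℕ → ℕ → Bool
  nwParity i j = west i j xor north i j
  seParity i j = south i j xor east i j
  swParity i j = west i j xor south i j
  neParity i j = north i j xor east i j

  A-bounds : ∀ x y → A x y ≡ true → x < m × y < n
  A-bounds x y x∈A = <ᵇ⇒< x m (Equivalence.from T-≡ (∧-conicalˡ (x <ᵇ m) _ x∈A))
                   , <ᵇ⇒< y n (Equivalence.from T-≡ (∧-conicalˡ (y <ᵇ n) _ (∧-conicalʳ (x <ᵇ m) _ x∈A)))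

  diagSeg-black : ∀ x y → isBlack x y ≡ true → diagSeg m n u x y ≡ A x y ∧ A (suc x) (suc y)
  diagSeg-black x y black rewrite black = refl

  diagSeg-white : ∀ x y → isBlack x y ≡ false → diagSeg m n u x y ≡ A (suc x) y ∧ A x (suc y)
  diagSeg-white x y white rewrite white = refl

  hSegAt-white : ∀ i j → isBlack i j ≡ false →
                 hSegAt m n u i j ≡ west i j ∧ (east i j ∧ (not (north i j) ∧ not (south i j)))
  hSegAt-white zero    j _ = refl
  hSegAt-white (suc i) j white rewrite white = refl

  vSegAt-white : ∀ i j → isBlack i j ≡ false →
                 vSegAt m n u i j ≡ south i j ∧ (north i j ∧ (not (east i j) ∧ not (west i j)))
  vSegAt-white i zero    _ = refl
  vSegAt-white i (suc j) white rewrite white = refl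

  hSegAt-black : ∀ i j → isBlack i j ≡ true → hSegAt m n u i j ≡ false
  hSegAt-black zero    j _ = refl
  hSegAt-black (suc i) j black rewrite black = refl

  vSegAt-black : ∀ i j → isBlack i j ≡ true → vSegAt m n u i j ≡ false
  vSegAt-black i zero    _ = refl
  vSegAt-black i (suc j) black rewrite black = refl

  record HSegCentre (i j : ℕ) : Set where
    field
      white   : isBlack i j ≡ false
      west∈A  : west i j ≡ true
      east∈A  : east i j ≡ true
      north∉A : north i j ≡ false
      south∉A : south i j ≡ false

  record VSegCentre (i j : ℕ) : Set where
    field
      white   : isBlack i j ≡ false
      south∈A : south i j ≡ true
      north∈A : north i j ≡ true
      east∉A  : east i j ≡ false
      west∉A  : west i j ≡ false

  hSegAt-centre : ∀ i j → hSegAt m n u i j ≡ true → HSegCentre i j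
  hSegAt-centre zero    j ()
  hSegAt-centre (suc i) j seg with ∧-true⁵ _ _ _ _ _ seg
  ... | white , w∈A , e∈A , n∉A , s∉A = record
    { white   = not-injective white
    ; west∈A  = w∈A
    ; east∈A  = e∈A
    ; north∉A = not-injective n∉A
    ; south∉A = not-injective s∉A
    }

  vSegAt-centre : ∀ i j → vSegAt m n u i j ≡ true → VSegCentre i j
  vSegAt-centre i zero    ()
  vSegAt-centre i (suc j) seg with ∧-true⁵ _ _ _ _ _ seg
  ... | white , s∈A , n∈A , e∉A , w∉A = record
    { white   = not-injective white
    ; south∈A = s∈A
    ; north∈A = n∈A
    ; east∉A  = not-injective e∉A
    ; west∉A  = not-injective w∉A
    }

  vSegAt-at-hSeg : ∀ i j → hSegAt m n u i j ≡ true → vSegAt m n u i j ≡ false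
  vSegAt-at-hSeg i j seg =
    trans (vSegAt-white i j white) (cong (_∧ (north i j ∧ (not (east i j) ∧ not (west i j)))) south∉A)
    where open HSegCentre (hSegAt-centre i j seg)

  hSegAt-at-vSeg : ∀ i j → vSegAt m n u i j ≡ true → hSegAt m n u i j ≡ false
  hSegAt-at-vSeg i j seg =
    trans (hSegAt-white i j white) (cong (_∧ (east i j ∧ (not (north i j) ∧ not (south i j)))) west∉A)
    where open VSegCentre (vSegAt-centre i j seg)

  vCov-above-hSeg : ∀ i j → hSegAt m n u i j ≡ true → vCov m n u i j ≡ false
  vCov-above-hSeg i j seg = cong₂ _∨_ (vSegAt-at-hSeg i j seg) (vSegAt-black i (suc j) black)
    where
    black : isBlack i (suc j) ≡ true
    black = trans (isBlack-sucʳ i j) (cong not (HSegCentre.white (hSegAt-centre i j seg)))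

  vCov-below-hSeg : ∀ i j → hSegAt m n u i (suc j) ≡ true → vCov m n u i j ≡ false
  vCov-below-hSeg i j seg = cong₂ _∨_ (vSegAt-black i j black) (vSegAt-at-hSeg i (suc j) seg)
    where
    black : isBlack i j ≡ true
    black = not-injective (trans (sym (isBlack-sucʳ i j)) (HSegCentre.white (hSegAt-centre i (suc j) seg)))

  hCov-right-vSeg : ∀ i j → vSegAt m n u i j ≡ true → hCov m n u i j ≡ false
  hCov-right-vSeg i j seg = cong₂ _∨_ (hSegAt-at-vSeg i j seg) (hSegAt-black (suc i) j black)
    where
    black : isBlack (suc i) j ≡ true
    black = trans (isBlack-sucˡ i j) (cong not (VSegCentre.white (vSegAt-centre i j seg)))

  hCov-left-vSeg : ∀ i j → vSegAt m n u (suc i) j ≡ true → hCov m n u i j ≡ false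
  hCov-left-vSeg i j seg = cong₂ _∨_ (hSegAt-black i j black) (hSegAt-at-vSeg (suc i) j seg)
    where
    black : isBlack i j ≡ true
    black = not-injective (trans (sym (isBlack-sucˡ i j)) (VSegCentre.white (vSegAt-centre (suc i) j seg)))

module Kernel (m n : ℕ) (u : Fn) (ker : InKerBW m n u) where
  open Neighbourhood m n u

  nw≡se : ∀ i j → i < m → j < n → isBlack i j ≡ false → nwParity i j ≡ seParity i j
  nw≡se i j i<m j<n white =
    proj₁ (xor-balance (east i j) (north i j) (west i j) (south i j) (ker i j i<m j<n white))

  sw≡ne : ∀ i j → i < m → j < n → isBlack i j ≡ false → swParity i j ≡ neParity i j
  sw≡ne i j i<m j<n white =
    proj₂ (xor-balance (east i j) (north i j) (west i j) (south i j) (ker i j i<m j<n white))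

  nwParity-antidiagonal : ∀ {i j x y} → x ≤ i → i + j ≡ x + y → i < m → y < n → isBlack i j ≡ false →
                          nwParity i j ≡ nwParity x y
  nwParity-antidiagonal {i} {j} {x} {y} x≤i e i<m y<n white with m≤n⇒m<n∨m≡n x≤i
  ... | inj₂ refl = cong (nwParity x) (+-cancelˡ-≡ x j y e)
  nwParity-antidiagonal {suc i} {j} {x} {y} _ e 1+i<m y<n white | inj₁ x<1+i =
    trans (sym (nw≡se i (suc j) i<m 1+j<n white′)) (nwParity-antidiagonal (≤-pred x<1+i) e′ i<m y<n white′)
    where
    i<m : i < m
    i<m = <-trans (n<1+n i) 1+i<m
    e′ : i + suc j ≡ x + y
    e′ = trans (+-suc i j) e
    white′ : isBlack i (suc j) ≡ false
    white′ = trans (cong isEven (+-suc i j)) white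
    1+j≤y : suc j ≤ y
    1+j≤y = +-cancelˡ-≤ x (suc j) y (≤-trans (+-monoˡ-≤ (suc j) (≤-pred x<1+i)) (≤-reflexive e′))
    1+j<n : suc j < n
    1+j<n = ≤-<-trans 1+j≤y y<n

  swParity-diagonal : ∀ {i j x y} → x ≤ i → i + y ≡ j + x → i < m → j < n → isBlack i j ≡ false →
                      swParity i j ≡ swParity x y
  swParity-diagonal {i} {j} {x} {y} x≤i e i<m j<n white with m≤n⇒m<n∨m≡n x≤i
  ... | inj₂ refl = cong (swParity x) (sym (+-cancelˡ-≡ x y j (trans e (+-comm j x))))
  swParity-diagonal {suc i} {zero}  {x} {y} _ e _ _ _ | inj₁ x<1+i =
    ⊥-elim (<⇒≱ x<1+i (subst (suc i ≤_) e (m≤m+n (suc i) y)))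
  swParity-diagonal {suc i} {suc j} {x} {y} _ e 1+i<m 1+j<n white | inj₁ x<1+i =
    trans (sym (sw≡ne i j i<m j<n white′)) (swParity-diagonal (≤-pred x<1+i) (suc-injective e) i<m j<n white′)
    where
    i<m : i < m
    i<m = <-trans (n<1+n i) 1+i<m
    j<n : j < n
    j<n = <-trans (n<1+n j) 1+j<n
    white′ : isBlack i j ≡ false
    white′ = trans (sym (isBlack-suc-suc i j)) white

data Quadrant : Set where
  ne nw se sw : Quadrant

-- The triangle of square (x , y) with upper-triangle flag k has its right angle at a white corner
-- of the square; apex x y (isBlack x y) k is that corner and the quadrant around it holding the
-- triangle.
apex : ℕ → ℕ → Bool → Bool → ℕ × ℕ × Quadrant
apex x y true  false = suc x , y , nw
apex x y true  true  = x , suc y , se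
apex x y false false = x , y , ne
apex x y false true  = suc x , suc y , sw

apexOf : Tri → ℕ × ℕ × Quadrant
apexOf (x , y , k) = apex x y (isBlack x y) k

-- A triangle lies beyond the line lhs = rhs when its apex does; beyond decides for apexes on the line.
module Wall (m n : ℕ) (u : Fn) (lhs rhs : ℕ → ℕ → ℕ) (beyond : ℕ → ℕ → Quadrant → Bool) where

  sideAt : ℕ × ℕ × Quadrant → Bool
  sideAt (i , j , q) = sideOf (lhs i j) (rhs i j) (beyond i j q)

  wallSide : Tri → Bool
  wallSide t = sideAt (apexOf t)

  module Invariance
    (diagSeg-free : ∀ x y → SqIn m n x y → diagSeg m n u x y ≡ false →
                    wallSide (x , y , false) ≡ wallSide (x , y , true))
    (hSeg-free : ∀ i j → i < m → j < n → lhs i j ≡ rhs i j → hSegAt m n u i j ≡ false →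
                 (beyond i j se ≡ beyond i j ne) × (beyond i j sw ≡ beyond i j nw))
    (vSeg-free : ∀ i j → i < m → j < n → lhs i j ≡ rhs i j → vSegAt m n u i j ≡ false →
                 (beyond i j nw ≡ beyond i j ne) × (beyond i j sw ≡ beyond i j se))
    where

    across-h : ∀ x y black → SqIn m n x y → hCov m n u x (suc y) ≡ false →
               sideAt (apex x y black true) ≡ sideAt (apex x (suc y) (not black) false)
    across-h x y true  (1+x<m , 1+y<n) free = sideOf-cong (lhs x (suc y)) (rhs x (suc y)) λ on →
      proj₁ (hSeg-free x (suc y) (<-trans (n<1+n x) 1+x<m) 1+y<n on (∨-conicalˡ _ _ free))
    across-h x y false (1+x<m , 1+y<n) free = sideOf-cong (lhs (suc x) (suc y)) (rhs (suc x) (suc y)) λ on →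
      proj₂ (hSeg-free (suc x) (suc y) 1+x<m 1+y<n on (∨-conicalʳ _ _ free))

    across-v : ∀ x y black → SqIn m n x y → vCov m n u (suc x) y ≡ false →
               sideAt (apex x y black (not black)) ≡ sideAt (apex (suc x) y (not black) (not black))
    across-v x y true  (1+x<m , 1+y<n) free = sideOf-cong (lhs (suc x) y) (rhs (suc x) y) λ on →
      proj₁ (vSeg-free (suc x) y 1+x<m (<-trans (n<1+n y) 1+y<n) on (∨-conicalˡ _ _ free))
    across-v x y false (1+x<m , 1+y<n) free = sideOf-cong (lhs (suc x) (suc y)) (rhs (suc x) (suc y)) λ on →
      proj₂ (vSeg-free (suc x) (suc y) 1+x<m 1+y<n on (∨-conicalʳ _ _ free))

    wallSide-adj : ∀ {s t} → Adj m n u s t → wallSide s ≡ wallSide t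
    wallSide-adj (inSq {x} {y} sq free) = diagSeg-free x y sq free
    wallSide-adj (acrossH {x} {y} sq _ free) =
      subst (λ b → sideAt (apex x y (isBlack x y) true) ≡ sideAt (apex x (suc y) b false))
            (sym (isBlack-sucʳ x y)) (across-h x y (isBlack x y) sq free)
    wallSide-adj (acrossV {x} {y} sq _ free) =
      subst (λ b → sideAt (apex x y (isBlack x y) (not (isBlack x y))) ≡ sideAt (apex (suc x) y b b))
            (sym (isBlack-sucˡ x y)) (across-v x y (isBlack x y) sq free)

    wallSide-conn : ∀ {s t} → Conn m n u s t → wallSide s ≡ wallSide t
    wallSide-conn = Star.fold (λ s t → wallSide s ≡ wallSide t) (trans ∘ Sym.fold sym wallSide-adj) refl

    chunk-one-side : ∀ {r s t} → Conn m n u r s → Conn m n u r t →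
                     wallSide s ≡ false → wallSide t ≡ true → ⊥
    chunk-one-side r~s r~t s-false t-true
      with trans (sym s-false) (trans (sym (wallSide-conn r~s)) (trans (wallSide-conn r~t) t-true))
    ... | ()

-- On a wall point w each odd pair of neighbours contains exactly one point of A_u, and the wall
-- runs through those points; these say which quadrants of w lie above the anti-diagonal wall,
-- resp. below the diagonal wall.
aboveAntidiagonal : Bool → Bool → Quadrant → Bool
aboveAntidiagonal north east ne = not (north ∧ east)
aboveAntidiagonal north east nw = not north
aboveAntidiagonal north east se = not east
aboveAntidiagonal north east sw = not north ∧ not east

belowDiagonal : Bool → Bool → Quadrant → Bool
belowDiagonal south east ne = not east
belowDiagonal south east nw = not south ∧ not east
belowDiagonal south east se = not (south ∧ east)
belowDiagonal south east sw = not south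

aboveAntidiagonal-hSeg-free : ∀ w s n e → w xor n ≡ true → s xor e ≡ true →
  w ∧ (e ∧ (not n ∧ not s)) ≡ false →
  (aboveAntidiagonal n e se ≡ aboveAntidiagonal n e ne) × (aboveAntidiagonal n e sw ≡ aboveAntidiagonal n e nw)
aboveAntidiagonal-hSeg-free w     s     true  true  _ _ _ = refl , refl
aboveAntidiagonal-hSeg-free w     s     true  false _ _ _ = refl , refl
aboveAntidiagonal-hSeg-free w     s     false false _ _ _ = refl , refl
aboveAntidiagonal-hSeg-free true  false false true  _ _ ()
aboveAntidiagonal-hSeg-free true  true  false true  _ () _
aboveAntidiagonal-hSeg-free false s     false true  () _ _

aboveAntidiagonal-vSeg-free : ∀ w s n e → w xor n ≡ true → s xor e ≡ true →
  s ∧ (n ∧ (not e ∧ not w)) ≡ false →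
  (aboveAntidiagonal n e nw ≡ aboveAntidiagonal n e ne) × (aboveAntidiagonal n e sw ≡ aboveAntidiagonal n e se)
aboveAntidiagonal-vSeg-free w     s     true  true  _ _ _ = refl , refl
aboveAntidiagonal-vSeg-free w     s     false true  _ _ _ = refl , refl
aboveAntidiagonal-vSeg-free w     s     false false _ _ _ = refl , refl
aboveAntidiagonal-vSeg-free false true  true  false _ _ ()
aboveAntidiagonal-vSeg-free false false true  false _ () _
aboveAntidiagonal-vSeg-free true  s     true  false () _ _

belowDiagonal-hSeg-free : ∀ w s n e → w xor s ≡ true → n xor e ≡ true →
  w ∧ (e ∧ (not n ∧ not s)) ≡ false →
  (belowDiagonal s e se ≡ belowDiagonal s e ne) × (belowDiagonal s e sw ≡ belowDiagonal s e nw)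
belowDiagonal-hSeg-free w     true  n     true  _ _ _ = refl , refl
belowDiagonal-hSeg-free w     true  n     false _ _ _ = refl , refl
belowDiagonal-hSeg-free w     false n     false _ _ _ = refl , refl
belowDiagonal-hSeg-free true  false false true  _ _ ()
belowDiagonal-hSeg-free true  false true  true  _ () _
belowDiagonal-hSeg-free false false n     true  () _ _

belowDiagonal-vSeg-free : ∀ w s n e → w xor s ≡ true → n xor e ≡ true →
  s ∧ (n ∧ (not e ∧ not w)) ≡ false →
  (belowDiagonal s e nw ≡ belowDiagonal s e ne) × (belowDiagonal s e sw ≡ belowDiagonal s e se)
belowDiagonal-vSeg-free w     true  n     true  _ _ _ = refl , refl
belowDiagonal-vSeg-free w     false n     true  _ _ _ = refl , refl
belowDiagonal-vSeg-free w     false n     false _ _ _ = refl , refl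
belowDiagonal-vSeg-free false true  true  false _ _ ()
belowDiagonal-vSeg-free false true  false false _ () _
belowDiagonal-vSeg-free true  true  n     false () _ _

module AntidiagonalWall (m n : ℕ) (u : Fn) (ker : InKerBW m n u) (x₀ y₀ : ℕ) (x₀<m : x₀ < m) (y₀<n : y₀ < n)
                        (white : isBlack x₀ y₀ ≡ false) (odd : Neighbourhood.nwParity m n u x₀ y₀ ≡ true) where
  open Neighbourhood m n u
  open Kernel m n u ker

  onWall-white : ∀ i j → i + j ≡ x₀ + y₀ → isBlack i j ≡ false
  onWall-white i j e = trans (cong isEven e) white

  onWall-nw : ∀ i j → i < m → j < n → i + j ≡ x₀ + y₀ → nwParity i j ≡ true
  onWall-nw i j i<m j<n e with ≤-total x₀ i
  ... | inj₁ x₀≤i = trans (nwParity-antidiagonal x₀≤i e i<m y₀<n (onWall-white i j e)) odd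
  ... | inj₂ i≤x₀ = trans (sym (nwParity-antidiagonal i≤x₀ (sym e) x₀<m j<n white)) odd

  onWall-se : ∀ i j → i < m → j < n → i + j ≡ x₀ + y₀ → seParity i j ≡ true
  onWall-se i j i<m j<n e = trans (sym (nw≡se i j i<m j<n (onWall-white i j e))) (onWall-nw i j i<m j<n e)

  beyond : ℕ → ℕ → Quadrant → Bool
  beyond i j = aboveAntidiagonal (north i j) (east i j)

  open Wall m n u _+_ (λ _ _ → x₀ + y₀) beyond public

  diagSeg-free : ∀ x y → SqIn m n x y → diagSeg m n u x y ≡ false →
                 wallSide (x , y , false) ≡ wallSide (x , y , true)
  diagSeg-free x y (1+x<m , 1+y<n) free = by-colour (isBlack x y) refl
    where
    by-colour : ∀ b → isBlack x y ≡ b → sideAt (apex x y b false) ≡ sideAt (apex x y b true)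
    by-colour true  _     = cong (λ d → sideOf d (x₀ + y₀) (not (A (suc x) (suc y)))) (sym (+-suc x y))
    by-colour false white′ = trans (sideOf-+2 off-parity (λ _ → cong not near-free) far-covered)
                                   (cong (λ d → sideOf d (x₀ + y₀) (beyond (suc x) (suc y) sw))
                                         (sym (cong suc (+-suc x y))))
      where
      near-free : A x (suc y) ∧ A (suc x) y ≡ false
      near-free = trans (∧-comm (A x (suc y)) (A (suc x) y)) (trans (sym (diagSeg-white x y white′)) free)
      off-parity : suc (x + y) ≢ x₀ + y₀
      off-parity e with trans (sym (trans (isEven-suc (x + y)) (cong not white′))) (onWall-white 0 (suc (x + y)) e)
      ... | ()
      far-covered : suc (suc (x + y)) ≡ x₀ + y₀ → beyond (suc x) (suc y) sw ≡ false
      far-covered e = xor-true-partners (west (suc x) (suc y)) (north (suc x) (suc y))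
                                        (south (suc x) (suc y)) (east (suc x) (suc y))
                        (onWall-nw (suc x) (suc y) 1+x<m 1+y<n e′) (onWall-se (suc x) (suc y) 1+x<m 1+y<n e′) near-free
        where
        e′ : suc x + suc y ≡ x₀ + y₀
        e′ = trans (cong suc (+-suc x y)) e

  hSeg-free : ∀ i j → i < m → j < n → i + j ≡ x₀ + y₀ → hSegAt m n u i j ≡ false →
              (beyond i j se ≡ beyond i j ne) × (beyond i j sw ≡ beyond i j nw)
  hSeg-free i j i<m j<n e noSeg = aboveAntidiagonal-hSeg-free (west i j) (south i j) (north i j) (east i j)
    (onWall-nw i j i<m j<n e) (onWall-se i j i<m j<n e) (trans (sym (hSegAt-white i j (onWall-white i j e))) noSeg)

  vSeg-free : ∀ i j → i < m → j < n → i + j ≡ x₀ + y₀ → vSegAt m n u i j ≡ false →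
              (beyond i j nw ≡ beyond i j ne) × (beyond i j sw ≡ beyond i j se)
  vSeg-free i j i<m j<n e noSeg = aboveAntidiagonal-vSeg-free (west i j) (south i j) (north i j) (east i j)
    (onWall-nw i j i<m j<n e) (onWall-se i j i<m j<n e) (trans (sym (vSegAt-white i j (onWall-white i j e))) noSeg)

  open Invariance diagSeg-free hSeg-free vSeg-free public

module DiagonalWall (m n : ℕ) (u : Fn) (ker : InKerBW m n u) (x₀ y₀ : ℕ) (x₀<m : x₀ < m) (y₀<n : y₀ < n)
                    (white : isBlack x₀ y₀ ≡ false) (odd : Neighbourhood.swParity m n u x₀ y₀ ≡ true) where
  open Neighbourhood m n u
  open Kernel m n u ker

  onWall-white : ∀ i j → i + y₀ ≡ j + x₀ → isBlack i j ≡ false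
  onWall-white i j e = trans (isBlack-diagonal i j x₀ y₀ e) white

  onWall-sw : ∀ i j → i < m → j < n → i + y₀ ≡ j + x₀ → swParity i j ≡ true
  onWall-sw i j i<m j<n e with ≤-total x₀ i
  ... | inj₁ x₀≤i = trans (swParity-diagonal x₀≤i e i<m j<n (onWall-white i j e)) odd
  ... | inj₂ i≤x₀ = trans (sym (swParity-diagonal i≤x₀ e′ x₀<m y₀<n white)) odd
    where
    e′ : x₀ + j ≡ y₀ + i
    e′ = trans (+-comm x₀ j) (trans (sym e) (+-comm i y₀))

  onWall-ne : ∀ i j → i < m → j < n → i + y₀ ≡ j + x₀ → neParity i j ≡ true
  onWall-ne i j i<m j<n e = trans (sym (sw≡ne i j i<m j<n (onWall-white i j e))) (onWall-sw i j i<m j<n e)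

  beyond : ℕ → ℕ → Quadrant → Bool
  beyond i j = belowDiagonal (south i j) (east i j)

  open Wall m n u (λ i _ → i + y₀) (λ _ j → j + x₀) beyond public

  diagSeg-free : ∀ x y → SqIn m n x y → diagSeg m n u x y ≡ false →
                 wallSide (x , y , false) ≡ wallSide (x , y , true)
  diagSeg-free x y (1+x<m , 1+y<n) free = by-colour (isBlack x y) refl
    where
    by-colour : ∀ b → isBlack x y ≡ b → sideAt (apex x y b false) ≡ sideAt (apex x y b true)
    by-colour false _     = sym (sideOf-suc (x + y₀) (y + x₀) (not (east x y)))
    by-colour true  black = sideOf-shift off-wall near-covered (λ _ → cong not far-free)
      where
      far-free : A x y ∧ A (suc x) (suc y) ≡ false
      far-free = trans (sym (diagSeg-black x y black)) free
      off-wall : x + y₀ ≢ y + x₀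
      off-wall e with trans (sym black) (onWall-white x y e)
      ... | ()
      y<n : y < n
      y<n = <-trans (n<1+n y) 1+y<n
      near-covered : suc (x + y₀) ≡ y + x₀ → beyond (suc x) y nw ≡ false
      near-covered e = xor-true-partners (west (suc x) y) (south (suc x) y) (north (suc x) y) (east (suc x) y)
        (onWall-sw (suc x) y 1+x<m y<n e) (onWall-ne (suc x) y 1+x<m y<n e) far-free

  hSeg-free : ∀ i j → i < m → j < n → i + y₀ ≡ j + x₀ → hSegAt m n u i j ≡ false →
              (beyond i j se ≡ beyond i j ne) × (beyond i j sw ≡ beyond i j nw)
  hSeg-free i j i<m j<n e noSeg = belowDiagonal-hSeg-free (west i j) (south i j) (north i j) (east i j)
    (onWall-sw i j i<m j<n e) (onWall-ne i j i<m j<n e) (trans (sym (hSegAt-white i j (onWall-white i j e))) noSeg)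

  vSeg-free : ∀ i j → i < m → j < n → i + y₀ ≡ j + x₀ → vSegAt m n u i j ≡ false →
              (beyond i j nw ≡ beyond i j ne) × (beyond i j sw ≡ beyond i j se)
  vSeg-free i j i<m j<n e noSeg = belowDiagonal-vSeg-free (west i j) (south i j) (north i j) (east i j)
    (onWall-sw i j i<m j<n e) (onWall-ne i j i<m j<n e) (trans (sym (vSegAt-white i j (onWall-white i j e))) noSeg)

  open Invariance diagSeg-free hSeg-free vSeg-free public

module ActiveRun (B : ℕ → Set) (seg : ℕ → Bool) (no-seg-at-0 : seg 0 ≡ false)
                 (seg-pairs : ∀ c → seg (suc c) ≡ true → B c ⇔ B (suc c))
                 (seg-breaks : ∀ c → seg (suc (suc c)) ≡ true → B c → B (suc c) → ⊥) where

  private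
    shift : ∀ (P : ℕ → Set) a {k} → (∀ i → i < k → P (a + i)) → ∀ i → i < k → P (i + a)
    shift P a h i i<k = subst P (+-comm a i) (h i i<k)

  Covered : ℕ → Set
  Covered i = seg i ∨ seg (suc i) ≡ true

  first-unsegmented : ∀ a → (∀ a′ → a ≡ suc a′ → ¬ B a′) → B a → seg a ≡ true → ⊥
  first-unsegmented zero     _     _   seg-0 with trans (sym no-seg-at-0) seg-0
  ... | ()
  first-unsegmented (suc a′) start B-a seg-a = start a′ refl (Equivalence.from (seg-pairs a′ seg-a) B-a)

  length≡2 : ∀ a k → 1 ≤ k → (∀ i → i < k → B (a + i)) → (∀ a′ → a ≡ suc a′ → ¬ B a′) → ¬ B (a + k) →
             (∀ i → i < k → Covered (a + i)) → k ≡ 2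
  length≡2 a (suc (suc zero)) _ _ _ _ _ = refl
  length≡2 a (suc zero) _ inRun start end covered with ∨-true (shift Covered a covered 0 z<s)
  ... | inj₁ seg-a   = ⊥-elim (first-unsegmented a start (shift B a inRun 0 z<s) seg-a)
  ... | inj₂ seg-a+1 =
    ⊥-elim (end (subst B (+-comm 1 a) (Equivalence.to (seg-pairs a seg-a+1) (shift B a inRun 0 z<s))))
  length≡2 a (suc (suc (suc k))) _ inRun _ _ covered with ∨-true (shift Covered a covered 2 (s<s (s<s z<s)))
  ... | inj₁ seg-a+2 = ⊥-elim (seg-breaks a seg-a+2 (shift B a inRun 0 z<s) (shift B a inRun 1 (s<s z<s)))
  ... | inj₂ seg-a+3 =
    ⊥-elim (seg-breaks (suc a) seg-a+3 (shift B a inRun 1 (s<s z<s)) (shift B a inRun 2 (s<s (s<s z<s))))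

module Chunk (m n : ℕ) (u : Fn) (ker : InKerBW m n u) (t₀ : Tri) where
  open Neighbourhood m n u

  Mem-⇔ : ∀ {x y k x′ y′ k′} → (SqIn m n x y ⇔ SqIn m n x′ y′) →
          (SqIn m n x y → SqIn m n x′ y′ → Adj m n u (x , y , k) (x′ , y′ , k′)) →
          Mem m n u t₀ x y k ⇔ Mem m n u t₀ x′ y′ k′
  Mem-⇔ sq⇔ adj = mk⇔
    (λ (sq , c) → let sq′ = Equivalence.to sq⇔ sq in sq′ , c ◅◅ fwd (adj sq sq′) ◅ ε)
    (λ (sq′ , c) → let sq = Equivalence.from sq⇔ sq′ in sq , c ◅◅ bwd (adj sq sq′) ◅ ε)

  SqIn-sucˡ : ∀ {x y} → suc (suc x) < m → SqIn m n x y ⇔ SqIn m n (suc x) y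
  SqIn-sucˡ x+2<m = mk⇔ (λ (_ , y+1<n) → x+2<m , y+1<n) (λ (x+2<m , y+1<n) → <-trans (n<1+n _) x+2<m , y+1<n)

  SqIn-sucʳ : ∀ {x y} → suc (suc y) < n → SqIn m n x y ⇔ SqIn m n x (suc y)
  SqIn-sucʳ y+2<n = mk⇔ (λ (x+1<m , _) → x+1<m , y+2<n) (λ (x+1<m , y+2<n) → x+1<m , <-trans (n<1+n _) y+2<n)

  acrossV-at : ∀ {x y k} → isBlack (suc x) y ≡ k → SqIn m n x y → SqIn m n (suc x) y →
               vCov m n u (suc x) y ≡ false → Adj m n u (x , y , k) (suc x , y , k)
  acrossV-at {x} {y} refl sq sq′ free =
    subst (λ k → Adj m n u (x , y , k) (suc x , y , isBlack (suc x) y)) (sym (isBlack-sucˡ x y)) (acrossV sq sq′ free)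

  acrossH-at : ∀ {x y k k′} → k ≡ true → k′ ≡ false → SqIn m n x y → SqIn m n x (suc y) →
               hCov m n u x (suc y) ≡ false → Adj m n u (x , y , k) (x , suc y , k′)
  acrossH-at refl refl = acrossH

  HAbove-pair : ∀ c y → hSegAt m n u (suc c) y ≡ true → HAbove m n u t₀ c y ⇔ HAbove m n u t₀ (suc c) y
  HAbove-pair c y seg = Mem-⇔ (SqIn-sucˡ (proj₁ (A-bounds (suc (suc c)) y east∈A))) λ sq sq′ →
    acrossV-at white sq sq′ (vCov-above-hSeg (suc c) y seg)
    where open HSegCentre (hSegAt-centre (suc c) y seg)

  HBelow-pair : ∀ c y → hSegAt m n u (suc c) y ≡ true → HBelow m n u t₀ c y ⇔ HBelow m n u t₀ (suc c) y
  HBelow-pair c zero    seg = mk⇔ (λ ()) (λ ())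
  HBelow-pair c (suc y) seg = Mem-⇔ (SqIn-sucˡ (proj₁ (A-bounds (suc (suc c)) (suc y) east∈A))) λ sq sq′ →
    acrossV-at black sq sq′ (vCov-below-hSeg (suc c) y seg)
    where
    open HSegCentre (hSegAt-centre (suc c) (suc y) seg)
    black : isBlack (suc c) y ≡ true
    black = not-injective (trans (sym (isBlack-sucʳ (suc c) y)) white)

  HBdry-pair : ∀ c y → hSegAt m n u (suc c) y ≡ true → HBdry m n u t₀ c y ⇔ HBdry m n u t₀ (suc c) y
  HBdry-pair c y seg = (HBelow-pair c y seg ×-⇔ ¬-cong-⇔ (HAbove-pair c y seg))
                    ⊎-⇔ (HAbove-pair c y seg ×-⇔ ¬-cong-⇔ (HBelow-pair c y seg))

  VRight-pair : ∀ x c → vSegAt m n u x (suc c) ≡ true → VRight m n u t₀ x c ⇔ VRight m n u t₀ x (suc c)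
  VRight-pair x c seg = Mem-⇔ (SqIn-sucʳ (proj₂ (A-bounds x (suc (suc c)) north∈A))) λ sq sq′ →
    acrossH-at black white sq sq′ (hCov-right-vSeg x (suc c) seg)
    where
    open VSegCentre (vSegAt-centre x (suc c) seg)
    black : isBlack x c ≡ true
    black = not-injective (trans (sym (isBlack-sucʳ x c)) white)

  VLeft-pair : ∀ x c → vSegAt m n u x (suc c) ≡ true → VLeft m n u t₀ x c ⇔ VLeft m n u t₀ x (suc c)
  VLeft-pair zero    c seg = mk⇔ (λ ()) (λ ())
  VLeft-pair (suc x) c seg = Mem-⇔ (SqIn-sucʳ (proj₂ (A-bounds (suc x) (suc (suc c)) north∈A))) λ sq sq′ →
    acrossH-at left-upper left-lower sq sq′ (hCov-left-vSeg x (suc c) seg)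
    where
    open VSegCentre (vSegAt-centre (suc x) (suc c) seg)
    left-upper : not (isBlack x c) ≡ true
    left-upper = trans (sym (isBlack-sucˡ x c)) (not-injective (trans (sym (isBlack-sucʳ (suc x) c)) white))
    left-lower : not (isBlack x (suc c)) ≡ false
    left-lower = trans (sym (isBlack-sucˡ x (suc c))) white

  VBdry-pair : ∀ x c → vSegAt m n u x (suc c) ≡ true → VBdry m n u t₀ x c ⇔ VBdry m n u t₀ x (suc c)
  VBdry-pair x c seg = (VLeft-pair x c seg ×-⇔ ¬-cong-⇔ (VRight-pair x c seg))
                    ⊎-⇔ (VRight-pair x c seg ×-⇔ ¬-cong-⇔ (VLeft-pair x c seg))

  HBdry-apex-white : ∀ {x y} → isBlack x y ≡ false → HBdry m n u t₀ x y →
                     ∃ λ t → Conn m n u t₀ t × ∃ λ q → apexOf t ≡ (x , y , q)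
  HBdry-apex-white {x} {y}     white (inj₂ ((_ , above) , _)) =
    (x , y , false) , above , ne , cong (λ b → apex x y b false) white
  HBdry-apex-white {x} {suc y} white (inj₁ ((_ , below) , _)) =
    (x , y , true) , below , se , cong (λ b → apex x y b true) (not-injective (trans (sym (isBlack-sucʳ x y)) white))

  HBdry-apex-black : ∀ {x y} → isBlack x y ≡ true → HBdry m n u t₀ x y →
                     ∃ λ t → Conn m n u t₀ t × (apexOf t ≡ (suc x , y , nw) ⊎ apexOf t ≡ (suc x , y , sw))
  HBdry-apex-black {x} {y}     black (inj₂ ((_ , above) , _)) =
    (x , y , false) , above , inj₁ (cong (λ b → apex x y b false) black)
  HBdry-apex-black {x} {suc y} black (inj₁ ((_ , below) , _)) =
    (x , y , true) , below , inj₂ (cong (λ b → apex x y b true) (not-injective (trans (sym (isBlack-sucʳ x y)) black)))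

  VBdry-apex-white : ∀ {x y} → isBlack x y ≡ false → VBdry m n u t₀ x y →
                     ∃ λ t → Conn m n u t₀ t × ∃ λ q → apexOf t ≡ (x , y , q)
  VBdry-apex-white {x}     {y} white (inj₂ ((_ , right) , _)) =
    (x , y , isBlack x y) , right , ne , cong (λ b → apex x y b b) white
  VBdry-apex-white {suc x} {y} white (inj₁ ((_ , left) , _)) =
    (x , y , not (isBlack x y)) , left , nw ,
    cong (λ b → apex x y b (not b)) (not-injective (trans (sym (isBlack-sucˡ x y)) white))

  VBdry-apex-black : ∀ {x y} → isBlack x y ≡ true → VBdry m n u t₀ x y →
                     ∃ λ t → Conn m n u t₀ t × (apexOf t ≡ (x , suc y , se) ⊎ apexOf t ≡ (x , suc y , sw))
  VBdry-apex-black {x}     {y} black (inj₂ ((_ , right) , _)) =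
    (x , y , isBlack x y) , right , inj₁ (cong (λ b → apex x y b b) black)
  VBdry-apex-black {suc x} {y} black (inj₁ ((_ , left) , _)) =
    (x , y , not (isBlack x y)) , left ,
    inj₂ (cong (λ b → apex x y b (not b)) (not-injective (trans (sym (isBlack-sucˡ x y)) black)))

  HBdry-breaks-at-hSeg : ∀ c y → hSegAt m n u (suc (suc c)) y ≡ true →
                         HBdry m n u t₀ c y → HBdry m n u t₀ (suc c) y → ⊥
  HBdry-breaks-at-hSeg c y seg bdry bdry′ = meet (HBdry-apex-white white-left bdry) (HBdry-apex-black black bdry′)
    where
    open HSegCentre (hSegAt-centre (suc (suc c)) y seg)
    c+3<m×y<n : suc (suc (suc c)) < m × y < n
    c+3<m×y<n = A-bounds (suc (suc (suc c))) y east∈A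
    c+2<m : suc (suc c) < m
    c+2<m = <-trans (n<1+n _) (proj₁ c+3<m×y<n)
    module D = AntidiagonalWall m n u ker (suc (suc c)) y c+2<m (proj₂ c+3<m×y<n) white (cong₂ _xor_ west∈A north∉A)
    module E = DiagonalWall m n u ker (suc (suc c)) y c+2<m (proj₂ c+3<m×y<n) white (cong₂ _xor_ west∈A south∉A)
    black : isBlack (suc c) y ≡ true
    black = not-injective (trans (sym (isBlack-sucˡ (suc c) y)) white)
    white-left : isBlack c y ≡ false
    white-left = not-injective (trans (sym (isBlack-sucˡ c y)) black)
    behind : c + y < suc (suc c) + y
    behind = m<n⇒m<1+n (n<1+n (c + y))
    D-behind : ∀ q → D.sideAt (c , y , q) ≡ false
    D-behind q = sideOf-< _ behind
    E-behind : ∀ q → E.sideAt (c , y , q) ≡ false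
    E-behind q = sideOf-< _ (subst (c + y <_) (+-comm (suc (suc c)) y) behind)
    D-nw : D.sideAt (suc (suc c) , y , nw) ≡ true
    D-nw = trans (sideOf-≡ _ refl) (cong not north∉A)
    E-sw : E.sideAt (suc (suc c) , y , sw) ≡ true
    E-sw = trans (sideOf-≡ _ (+-comm (suc (suc c)) y)) (cong not south∉A)
    meet : (∃ λ t → Conn m n u t₀ t × ∃ λ q → apexOf t ≡ (c , y , q)) →
           (∃ λ t → Conn m n u t₀ t × (apexOf t ≡ (suc (suc c) , y , nw) ⊎ apexOf t ≡ (suc (suc c) , y , sw))) → ⊥
    meet (_ , t∈ , q , t-apex) (_ , t′∈ , inj₁ t′-apex) =
      D.chunk-one-side t∈ t′∈ (trans (cong D.sideAt t-apex) (D-behind q)) (trans (cong D.sideAt t′-apex) D-nw)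
    meet (_ , t∈ , q , t-apex) (_ , t′∈ , inj₂ t′-apex) =
      E.chunk-one-side t∈ t′∈ (trans (cong E.sideAt t-apex) (E-behind q)) (trans (cong E.sideAt t′-apex) E-sw)

  VBdry-breaks-at-vSeg : ∀ x c → vSegAt m n u x (suc (suc c)) ≡ true →
                         VBdry m n u t₀ x c → VBdry m n u t₀ x (suc c) → ⊥
  VBdry-breaks-at-vSeg x c seg bdry bdry′ = meet (VBdry-apex-white white-below bdry) (VBdry-apex-black black bdry′)
    where
    open VSegCentre (vSegAt-centre x (suc (suc c)) seg)
    x<m×c+3<n : x < m × suc (suc (suc c)) < n
    x<m×c+3<n = A-bounds x (suc (suc (suc c))) north∈A
    c+2<n : suc (suc c) < n
    c+2<n = <-trans (n<1+n _) (proj₂ x<m×c+3<n)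
    module D = AntidiagonalWall m n u ker x (suc (suc c)) (proj₁ x<m×c+3<n) c+2<n white (cong₂ _xor_ west∉A north∈A)
    module E = DiagonalWall m n u ker x (suc (suc c)) (proj₁ x<m×c+3<n) c+2<n white (cong₂ _xor_ west∉A south∈A)
    black : isBlack x (suc c) ≡ true
    black = not-injective (trans (sym (isBlack-sucʳ x (suc c))) white)
    white-below : isBlack x c ≡ false
    white-below = not-injective (trans (sym (isBlack-sucʳ x c)) black)
    behind : x + c < x + suc (suc c)
    behind = +-monoʳ-< x (m<n⇒m<1+n (n<1+n c))
    D-behind : ∀ q → D.sideAt (x , c , q) ≡ false
    D-behind q = sideOf-< _ behind
    E-behind : ∀ q → E.sideAt (x , c , q) ≡ true
    E-behind q = sideOf-> _ (subst (_< x + suc (suc c)) (+-comm x c) behind)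
    D-se : D.sideAt (x , suc (suc c) , se) ≡ true
    D-se = trans (sideOf-≡ _ refl) (cong not east∉A)
    E-sw : E.sideAt (x , suc (suc c) , sw) ≡ false
    E-sw = trans (sideOf-≡ _ (+-comm x (suc (suc c)))) (cong not south∈A)
    meet : (∃ λ t → Conn m n u t₀ t × ∃ λ q → apexOf t ≡ (x , c , q)) →
           (∃ λ t → Conn m n u t₀ t × (apexOf t ≡ (x , suc (suc c) , se) ⊎ apexOf t ≡ (x , suc (suc c) , sw))) → ⊥
    meet (_ , t∈ , q , t-apex) (_ , t′∈ , inj₁ t′-apex) =
      D.chunk-one-side t∈ t′∈ (trans (cong D.sideAt t-apex) (D-behind q)) (trans (cong D.sideAt t′-apex) D-se)
    meet (_ , t∈ , q , t-apex) (_ , t′∈ , inj₂ t′-apex) =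
      E.chunk-one-side t′∈ t∈ (trans (cong E.sideAt t′-apex) E-sw) (trans (cong E.sideAt t-apex) (E-behind q))

  HStartMax-prev : ∀ a y → HStartMax m n u t₀ a y → ∀ a′ → a ≡ suc a′ → ¬ HBdry m n u t₀ a′ y
  HStartMax-prev (suc a) y start .a refl = start

  VStartMax-prev : ∀ x b → VStartMax m n u t₀ x b → ∀ b′ → b ≡ suc b′ → ¬ VBdry m n u t₀ x b′
  VStartMax-prev x (suc b) start .b refl = start

lemma4 : (m n : ℕ) → 2 ≤ m → 2 ≤ n → (u : Fn) → InKerBW m n u → NonZeroOnBlack m n u →
    (x0 y0 : ℕ) (k0 : Bool) → SqIn m n x0 y0 →
    ((a y k : ℕ) → HActiveSide m n u (x0 , y0 , k0) a y k → k ≡ 2) ×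
    ((x b k : ℕ) → VActiveSide m n u (x0 , y0 , k0) x b k → k ≡ 2)
lemma4 m n _ _ u ker _ x0 y0 k0 _ = horizontal , vertical
  where
  open Chunk m n u ker (x0 , y0 , k0)
  horizontal : (a y k : ℕ) → HActiveSide m n u (x0 , y0 , k0) a y k → k ≡ 2
  horizontal a y k (1≤k , inRun , start , end , covered) =
    ActiveRun.length≡2 (λ x → HBdry m n u (x0 , y0 , k0) x y) (λ x → hSegAt m n u x y) refl
      (λ c → HBdry-pair c y) (λ c → HBdry-breaks-at-hSeg c y) a k 1≤k inRun (HStartMax-prev a y start) end covered
  vertical : (x b k : ℕ) → VActiveSide m n u (x0 , y0 , k0) x b k → k ≡ 2
  vertical x b k (1≤k , inRun , start , end , covered) =
    ActiveRun.length≡2 (VBdry m n u (x0 , y0 , k0) x) (vSegAt m n u x) refl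
      (VBdry-pair x) (VBdry-breaks-at-vSeg x) b k 1≤k inRun (VStartMax-prev x b start) end covered
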